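{- Let $p\ge2$, $n$, $k$ be positive integers and $\alpha\in(0,1/4]$ with $\alpha n$ an integer. Suppose there exists a streaming algorithm using $c$ bits of memory that achieves advantage $1/4$ in distinguishing between Unique Games instances from the $\mathbf{Y}$ distribution and the $\mathbf{N}$ distribution (with parameters $n,\alpha,k$). Then there exists a protocol with $c$ bits of communication for the $p$-ary Hidden Matching problem (with parameters $n,\alpha$) with advantage $\Omega(1/k)$ in distinguishing between its YES and NO distributions.
   Context: Both distributions: sample $k$ independent uniformly random $\alpha$-partial matchings (matchings with exactly $\alpha n$ edges) on $\{1,\dots,n\}$; the $\ell$-th matching is stage $\ell$, and the constraints are streamed stage by stage (all constraints of stage $\ell$ before those of stage $\ell+1$). In $\mathbf{Y}$, a uniformly random $z\in\mathbb{Z}_p^n$ is sampled and each edge $(u,v)$ gets the constraint $x_u+x_v=z_u+z_v$ (mod $p$). In $\mathbf{N}$, each edge $(u,v)$ gets the constraint $x_u+x_v=q$ with $q\in\mathbb{Z}_p$ uniform and independent across edges. An algorithm distinguishes two distributions with advantage $\eta$ if its probability of accepting differs by at least $\eta$ between them. The $p$-ary Hidden Matching problem: Alice gets uniformly random $x\in\mathbb{Z}_p^n$; Bob gets a uniformly random $\alpha$-partial matching with incidence matrix $M\in\{0,1\}^{\alpha n\times n}$ and $w\in\mathbb{Z}_p^{\alpha n}$, where in the YES distribution $w=Mx$ (mod $p$) and in the NO distribution $w$ is uniform and independent of $x$. Alice sends one message to Bob, who outputs Yes/No; the advantage is the difference between the probabilities of outputting Yes under the two distributions. -}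

module Defs where

open import Data.Bool using (Bool; true; false)
open import Data.Nat as ℕ using (ℕ; zero; suc; NonZero; _^_)
open import Data.Nat.DivMod using (_mod_)
open import Data.Fin as Fin using (Fin; toℕ)
open import Data.Fin.Properties using () renaming (_≟_ to _≟ᶠ_)
open import Data.Product using (_×_; _,_; proj₁; proj₂)
open import Data.List as List using (List; []; _∷_; length; map; cartesianProduct; filter; allFin)
open import Data.Vec as Vec using (Vec; []; _∷_; lookup; toList)
open import Data.Integer using (+_)
open import Data.Rational using (ℚ; 0ℚ; 1ℚ; _+_; _*_; _-_; _/_; ∣_∣)
import Data.List.Relation.Unary.Unique.DecPropositional as UniqueDec

allVecs : ∀ {a} {A : Set a} → List A → (k : ℕ) → List (Vec A k)
allVecs xs zero    = [] ∷ []
allVecs xs (suc k) = List.concatMap (λ x → map (x ∷_) (allVecs xs k)) xs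

sumℚ : List ℚ → ℚ
sumℚ = List.foldr _+_ 0ℚ

-- uniform average of f over the (multi)set listed by L; 0 on the empty list
avg : ∀ {a} {A : Set a} → List A → (A → ℚ) → ℚ
avg []       f = 0ℚ
avg (x ∷ xs) f = sumℚ (map f (x ∷ xs)) * (+ 1 / length (x ∷ xs))

ind : Bool → ℚ
ind true  = 1ℚ
ind false = 0ℚ

_+ₚ_ : ∀ {p} .{{_ : NonZero p}} → Fin p → Fin p → Fin p
_+ₚ_ {p} a b = (toℕ a ℕ.+ toℕ b) mod p

Edge : ℕ → Set
Edge n = Fin n × Fin n

-- a partial matching with m edges, listed in the order in which they are
-- streamed; it is a matching iff its 2m endpoints are pairwise distinct
Matching : ℕ → ℕ → Set
Matching n m = Vec (Edge n) m

endpoints : ∀ {n m} → Matching n m → List (Fin n)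
endpoints M = List.concatMap (λ e → proj₁ e ∷ proj₂ e ∷ []) (toList M)

-- all (ordered) m-edge partial matchings on {1..n}; averaging over this list
-- = sampling a uniformly random m-edge matching (in uniformly random order)
allMatchings : (n m : ℕ) → List (Matching n m)
allMatchings n m =
  filter (λ M → UniqueDec.unique? _≟ᶠ_ (endpoints M))
         (allVecs (cartesianProduct (allFin n) (allFin n)) m)

-- a Unique Games (Max-2Lin mod p) constraint  x_u + x_v = b
Constraint : ℕ → ℕ → Set
Constraint n p = Edge n × Fin p

-- Streaming algorithms with c bits of memory (memory states Fin (2^c)),
-- with an arbitrary finite random seed (Fin r, uniform); the update may
-- depend on the seed and on the position in the stream.

record StreamAlg (n p c : ℕ) : Set where
  field
    r      : ℕ
    init   : Fin r → Fin (2 ^ c)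
    step   : Fin r → ℕ → Fin (2 ^ c) → Constraint n p → Fin (2 ^ c)
    accept : Fin r → Fin (2 ^ c) → Bool

runFrom : ∀ {n p c} (A : StreamAlg n p c) → Fin (StreamAlg.r A) → ℕ
        → Fin (2 ^ c) → List (Constraint n p) → Fin (2 ^ c)
runFrom A s t σ []       = σ
runFrom A s t σ (x ∷ xs) = runFrom A s (suc t) (StreamAlg.step A s t σ x) xs

runAlg : ∀ {n p c} (A : StreamAlg n p c) → Fin (StreamAlg.r A) → List (Constraint n p) → Bool
runAlg A s xs = StreamAlg.accept A s (runFrom A s 0 (StreamAlg.init A s) xs)

streamY : ∀ {n p m k} .{{_ : NonZero p}} → Vec (Fin p) n → Vec (Matching n m) k → List (Constraint n p)
streamY z Ms = List.concatMap
  (λ M → map (λ e → (e , lookup z (proj₁ e) +ₚ lookup z (proj₂ e))) (toList M))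
  (toList Ms)

streamN : ∀ {n p m k} → Vec (Matching n m) k → Vec (Vec (Fin p) m) k → List (Constraint n p)
streamN []       []         = []
streamN (M ∷ Ms) (q ∷ qs) = toList (Vec.zip M q) List.++ streamN Ms qs

-- acceptance probability under Y (parameters n, α n = m, k)
accY : ∀ {n p c} .{{_ : NonZero p}} → StreamAlg n p c → (m k : ℕ) → ℚ
accY {n} {p} A m k =
  avg (allFin (StreamAlg.r A)) λ s →
  avg (allVecs (allFin p) n) λ z →
  avg (allVecs (allMatchings n m) k) λ Ms →
  ind (runAlg A s (streamY z Ms))

accN : ∀ {n p c} → StreamAlg n p c → (m k : ℕ) → ℚ
accN {n} {p} A m k =
  avg (allFin (StreamAlg.r A)) λ s →
  avg (allVecs (allMatchings n m) k) λ Ms →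
  avg (allVecs (allVecs (allFin p) m) k) λ qs →
  ind (runAlg A s (streamN Ms qs))

advantageUG : ∀ {n p c} .{{_ : NonZero p}} → StreamAlg n p c → (m k : ℕ) → ℚ
advantageUG A m k = ∣ accY A m k - accN A m k ∣

-- One-way protocols for p-ary Hidden Matching with c bits of communication
-- (Alice's message in Fin (2^c)), with public randomness Fin r (uniform).

record HMProtocol (n p m c : ℕ) : Set where
  field
    r     : ℕ
    alice : Fin r → Vec (Fin p) n → Fin (2 ^ c)
    bob   : Fin r → Fin (2 ^ c) → Matching n m → Vec (Fin p) m → Bool

-- w = M x (mod p): the entry for edge (u,v) is x_u + x_v
incidenceMul : ∀ {n p m} .{{_ : NonZero p}} → Matching n m → Vec (Fin p) n → Vec (Fin p) m
incidenceMul M x = Vec.map (λ e → lookup x (proj₁ e) +ₚ lookup x (proj₂ e)) M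

accYES : ∀ {n p m c} .{{_ : NonZero p}} → HMProtocol n p m c → ℚ
accYES {n} {p} {m} P =
  avg (allFin (HMProtocol.r P)) λ s →
  avg (allVecs (allFin p) n) λ x →
  avg (allMatchings n m) λ M →
  ind (HMProtocol.bob P s (HMProtocol.alice P s x) M (incidenceMul M x))

accNO : ∀ {n p m c} → HMProtocol n p m c → ℚ
accNO {n} {p} {m} P =
  avg (allFin (HMProtocol.r P)) λ s →
  avg (allVecs (allFin p) n) λ x →
  avg (allMatchings n m) λ M →
  avg (allVecs (allFin p) m) λ w →
  ind (HMProtocol.bob P s (HMProtocol.alice P s x) M w)

advantageHM : ∀ {n p m c} .{{_ : NonZero p}} → HMProtocol n p m c → ℚ
advantageHM P = ∣ accYES P - accNO P ∣

-- For a + b = k let hybrid a b be the acceptance probability of the streaming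
-- algorithm when the first a stages are drawn as in Y (labels z_u + z_v for a
-- hidden z) and the last b stages as in N (independent uniform labels).  Then
-- hybrid k 0 is the Y-acceptance and hybrid 0 k the N-acceptance, so some
-- consecutive pair of hybrids differs by at least advantage/k (telescoping).
-- For such a pair (stage i+1 being the switched one) the protocol shares the
-- algorithm's seed, the first i Y-matchings and the last k-i-1 N-stages as
-- public randomness; Alice (holding x = z) runs the first i stages and sends
-- the memory state; Bob feeds in his own stage (M, w) and the N-stages.  Under
-- YES Bob's stage is a Y-stage, under NO an N-stage, so the protocol's
-- advantage is exactly the gap between the two hybrids.

module Submission where

open import Data.Nat using (ℕ; zero; suc; NonZero)
open import Defs

module Arithmetic where
  import Data.Nat as ℕ
  open import Data.Integer as ℤ using (+_)
  import Data.Integer.Properties as ℤP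
  open import Data.Rational using (ℚ; 1ℚ; _+_; _*_; _/_; fromℚᵘ)
  open import Data.Rational.Properties
    using (toℚᵘ-injective; toℚᵘ-fromℚᵘ; toℚᵘ-homo-+; toℚᵘ-homo-*; fromℚᵘ-cong)
  import Data.Rational.Unnormalised as ℚᵘ
  import Data.Rational.Unnormalised.Properties as ℚᵘP
  open import Relation.Binary.PropositionalEquality using (_≡_; sym; trans; cong)

  toℚ : ℕ → ℚ
  toℚ n = + n / 1

  fromℚᵘ-homo-+ : ∀ a b → fromℚᵘ (a ℚᵘ.+ b) ≡ fromℚᵘ a + fromℚᵘ b
  fromℚᵘ-homo-+ a b = toℚᵘ-injective (ℚᵘP.≃-trans (toℚᵘ-fromℚᵘ (a ℚᵘ.+ b))
    (ℚᵘP.≃-sym (ℚᵘP.≃-trans (toℚᵘ-homo-+ (fromℚᵘ a) (fromℚᵘ b))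
      (ℚᵘP.+-cong (toℚᵘ-fromℚᵘ a) (toℚᵘ-fromℚᵘ b)))))

  fromℚᵘ-homo-* : ∀ a b → fromℚᵘ (a ℚᵘ.* b) ≡ fromℚᵘ a * fromℚᵘ b
  fromℚᵘ-homo-* a b = toℚᵘ-injective (ℚᵘP.≃-trans (toℚᵘ-fromℚᵘ (a ℚᵘ.* b))
    (ℚᵘP.≃-sym (ℚᵘP.≃-trans (toℚᵘ-homo-* (fromℚᵘ a) (fromℚᵘ b))
      (ℚᵘP.*-cong (toℚᵘ-fromℚᵘ a) (toℚᵘ-fromℚᵘ b)))))

  1/-homo-* : ∀ a b → + 1 / (suc a ℕ.* suc b) ≡ (+ 1 / suc a) * (+ 1 / suc b)
  1/-homo-* a b = fromℚᵘ-homo-* (+ 1 ℚᵘ./ suc a) (+ 1 ℚᵘ./ suc b)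

  toℚ-*-1/ : ∀ n → toℚ (suc n) * (+ 1 / suc n) ≡ 1ℚ
  toℚ-*-1/ n = trans (sym (fromℚᵘ-homo-* (+ suc n ℚᵘ./ 1) (+ 1 ℚᵘ./ suc n)))
    (fromℚᵘ-cong (ℚᵘP.*-inverseʳ (+ suc n ℚᵘ./ 1)))

  -- (n+1)/1 and 1/1 + n/1 are equal fractions: both cross-products are n+1
  toℚ-suc : ∀ n → toℚ (suc n) ≡ 1ℚ + toℚ n
  toℚ-suc n = trans
    (fromℚᵘ-cong {+ suc n ℚᵘ./ 1} {+ 1 ℚᵘ./ 1 ℚᵘ.+ + n ℚᵘ./ 1}
      (ℚᵘ.*≡* (trans (ℤP.*-identityʳ (+ suc n))
        (sym (trans (ℤP.*-identityʳ (+ 1 ℤ.+ + n ℤ.* + 1))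
                    (cong (ℤ._+_ (+ 1)) (ℤP.*-identityʳ (+ n))))))))
    (fromℚᵘ-homo-+ (+ 1 ℚᵘ./ 1) (+ n ℚᵘ./ 1))

module Averages where
  import Data.Nat as ℕ
  open import Data.Integer using (+_)
  open import Data.Rational using (ℚ; 0ℚ; 1ℚ; _+_; _*_; _/_)
  open import Data.Rational.Properties
    using ( +-identityˡ; +-identityʳ; +-assoc; *-identityˡ; *-identityʳ; *-zeroˡ
          ; *-distribʳ-+; +-0-commutativeMonoid; *-1-commutativeMonoid)
  open import Algebra.Bundles using (CommutativeMonoid)
  open import Algebra.Properties.CommutativeSemigroup
    (CommutativeMonoid.commutativeSemigroup +-0-commutativeMonoid)
    using () renaming (interchange to +-interchange)
  open import Algebra.Properties.CommutativeSemigroup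
    (CommutativeMonoid.commutativeSemigroup *-1-commutativeMonoid)
    using () renaming (x∙yz≈xz∙y to *-rearrange; xy∙z≈xz∙y to *-swapʳ)
  open import Data.List
    using (List; []; _∷_; map; length; _++_; concatMap; cartesianProductWith; allFin; lookup)
  import Data.List.Properties as ListP
  open import Data.Vec using (Vec; []; _∷_; _∷ʳ_)
  open import Function using (_∘_; id)
  open import Relation.Binary.PropositionalEquality
  open Arithmetic

  module _ {a} {A : Set a} where

    ∑ : List A → (A → ℚ) → ℚ
    ∑ xs f = sumℚ (map f xs)

    ∑-cong : ∀ xs {f g : A → ℚ} → (∀ x → f x ≡ g x) → ∑ xs f ≡ ∑ xs g
    ∑-cong xs f≗g = cong sumℚ (ListP.map-cong f≗g xs)

    ∑-zero : ∀ xs → ∑ xs (λ _ → 0ℚ) ≡ 0ℚ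
    ∑-zero []       = refl
    ∑-zero (x ∷ xs) = trans (+-identityˡ _) (∑-zero xs)

    ∑-+ : ∀ xs (f g : A → ℚ) → ∑ xs (λ x → f x + g x) ≡ ∑ xs f + ∑ xs g
    ∑-+ []       f g = sym (+-identityˡ 0ℚ)
    ∑-+ (x ∷ xs) f g =
      trans (cong (_+_ (f x + g x)) (∑-+ xs f g)) (+-interchange (f x) (g x) (∑ xs f) (∑ xs g))

    ∑-*ʳ : ∀ xs (f : A → ℚ) c → ∑ xs (λ x → f x * c) ≡ ∑ xs f * c
    ∑-*ʳ []       f c = sym (*-zeroˡ c)
    ∑-*ʳ (x ∷ xs) f c =
      trans (cong (_+_ (f x * c)) (∑-*ʳ xs f c)) (sym (*-distribʳ-+ c (f x) (∑ xs f)))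

    ∑-++ : ∀ xs ys (f : A → ℚ) → ∑ (xs ++ ys) f ≡ ∑ xs f + ∑ ys f
    ∑-++ []       ys f = sym (+-identityˡ _)
    ∑-++ (x ∷ xs) ys f =
      trans (cong (_+_ (f x)) (∑-++ xs ys f)) (sym (+-assoc (f x) (∑ xs f) (∑ ys f)))

    ∑-const : ∀ xs c → ∑ xs (λ _ → c) ≡ toℚ (length xs) * c
    ∑-const []       c = sym (*-zeroˡ c)
    ∑-const (x ∷ xs) c = begin
      c + ∑ xs (λ _ → c)            ≡⟨ cong (_+_ c) (∑-const xs c) ⟩
      c + toℚ (length xs) * c       ≡⟨ cong (_+ toℚ (length xs) * c) (sym (*-identityˡ c)) ⟩
      1ℚ * c + toℚ (length xs) * c  ≡⟨ sym (*-distribʳ-+ c 1ℚ (toℚ (length xs))) ⟩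
      (1ℚ + toℚ (length xs)) * c    ≡⟨ cong (_* c) (sym (toℚ-suc (length xs))) ⟩
      toℚ (suc (length xs)) * c     ∎
      where open ≡-Reasoning

  module _ {a b} {A : Set a} {B : Set b} where

    ∑-map : ∀ (g : A → B) (f : B → ℚ) xs → ∑ (map g xs) f ≡ ∑ xs (f ∘ g)
    ∑-map g f xs = cong sumℚ (sym (ListP.map-∘ xs))

    ∑-swap : ∀ (xs : List A) (ys : List B) (f : A → B → ℚ) →
      ∑ xs (λ x → ∑ ys (f x)) ≡ ∑ ys (λ y → ∑ xs (λ x → f x y))
    ∑-swap []       ys f = sym (∑-zero ys)
    ∑-swap (x ∷ xs) ys f = trans (cong (_+_ (∑ ys (f x))) (∑-swap xs ys f))
      (sym (∑-+ ys (f x) (λ y → ∑ xs (λ x → f x y))))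

  module _ {a b c} {A : Set a} {B : Set b} {C : Set c} where

    ∑-product : ∀ (g : A → B → C) xs ys (f : C → ℚ) →
      ∑ (cartesianProductWith g xs ys) f ≡ ∑ xs (λ x → ∑ ys (λ y → f (g x y)))
    ∑-product g []       ys f = refl
    ∑-product g (x ∷ xs) ys f =
      trans (∑-++ (map (g x) ys) (cartesianProductWith g xs ys) f)
            (cong₂ _+_ (∑-map (g x) f ys) (∑-product g xs ys f))

    length-product : ∀ (g : A → B → C) xs ys →
      length (cartesianProductWith g xs ys) ≡ length xs ℕ.* length ys
    length-product g []       ys = refl
    length-product g (x ∷ xs) ys =
      trans (ListP.length-++ (map (g x) ys))
            (cong₂ ℕ._+_ (ListP.length-map (g x) ys) (length-product g xs ys))

    -- Defs builds lists of vectors with concatMap; this is the library's product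
    concatMap-product : ∀ (g : A → B → C) xs ys →
      concatMap (λ x → map (g x) ys) xs ≡ cartesianProductWith g xs ys
    concatMap-product g []       ys = refl
    concatMap-product g (x ∷ xs) ys = cong (map (g x) ys ++_) (concatMap-product g xs ys)

  module _ {a} {A : Set a} where

    avg-by-length : ∀ xs n (f : A → ℚ) → length xs ≡ suc n → avg xs f ≡ ∑ xs f * (+ 1 / suc n)
    avg-by-length (x ∷ xs) n f refl = refl

    avg-cong : ∀ xs {f g : A → ℚ} → (∀ x → f x ≡ g x) → avg xs f ≡ avg xs g
    avg-cong []       f≗g = refl
    avg-cong (x ∷ xs) f≗g = cong (_* (+ 1 / suc (length xs))) (∑-cong (x ∷ xs) f≗g)

    avg-zero : ∀ xs → avg xs (λ (_ : A) → 0ℚ) ≡ 0ℚ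
    avg-zero []       = refl
    avg-zero (x ∷ xs) = trans (cong (_* w) (∑-zero (x ∷ xs))) (*-zeroˡ w)
      where w : ℚ
            w = + 1 / suc (length xs)

    avg-singleton : ∀ x (f : A → ℚ) → avg (x ∷ []) f ≡ f x
    avg-singleton x f = trans (*-identityʳ _) (+-identityʳ (f x))

    avg-const : ∀ (xs : List A) c → 0 ℕ.< length xs → avg xs (λ _ → c) ≡ c
    avg-const (x ∷ xs) c _ = begin
      ∑ (x ∷ xs) (λ _ → c) * w                ≡⟨ cong (_* w) (∑-const (x ∷ xs) c) ⟩
      toℚ (suc (length xs)) * c * w           ≡⟨ *-swapʳ (toℚ (suc (length xs))) c w ⟩
      toℚ (suc (length xs)) * w * c           ≡⟨ cong (_* c) (toℚ-*-1/ (length xs)) ⟩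
      1ℚ * c                                  ≡⟨ *-identityˡ c ⟩
      c                                       ∎
      where open ≡-Reasoning
            w : ℚ
            w = + 1 / suc (length xs)

  module _ {a b} {A : Set a} {B : Set b} where

    avg-swap : ∀ (xs : List A) (ys : List B) (f : A → B → ℚ) →
      avg xs (λ x → avg ys (f x)) ≡ avg ys (λ y → avg xs (λ x → f x y))
    avg-swap []       ys       f = sym (avg-zero ys)
    avg-swap (x ∷ xs) []       f = avg-zero (x ∷ xs)
    avg-swap (x ∷ xs) (y ∷ ys) f = begin
      ∑ (x ∷ xs) (λ x → ∑ (y ∷ ys) (f x) * v) * u
        ≡⟨ cong (_* u) (∑-*ʳ (x ∷ xs) (λ x → ∑ (y ∷ ys) (f x)) v) ⟩
      ∑ (x ∷ xs) (λ x → ∑ (y ∷ ys) (f x)) * v * u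
        ≡⟨ cong (λ t → t * v * u) (∑-swap (x ∷ xs) (y ∷ ys) f) ⟩
      T * v * u
        ≡⟨ *-swapʳ T v u ⟩
      T * u * v
        ≡⟨ cong (_* v) (sym (∑-*ʳ (y ∷ ys) (λ y → ∑ (x ∷ xs) (λ x → f x y)) u)) ⟩
      ∑ (y ∷ ys) (λ y → ∑ (x ∷ xs) (λ x → f x y) * u) * v ∎
      where open ≡-Reasoning
            u v T : ℚ
            u = + 1 / suc (length xs)
            v = + 1 / suc (length ys)
            T = ∑ (y ∷ ys) (λ y → ∑ (x ∷ xs) (λ x → f x y))

    avg-map : ∀ (g : A → B) (f : B → ℚ) xs → avg (map g xs) f ≡ avg xs (f ∘ g)
    avg-map g f []       = refl
    avg-map g f (x ∷ xs) =
      cong₂ _*_ (∑-map g f (x ∷ xs)) (cong (λ l → + 1 / suc l) (ListP.length-map g xs))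

  avg-lookup : ∀ {a} {A : Set a} (xs : List A) (f : A → ℚ) →
    avg (allFin (length xs)) (f ∘ lookup xs) ≡ avg xs f
  avg-lookup xs f = trans (sym (avg-map (lookup xs) f (allFin (length xs))))
    (cong (λ l → avg l f)
      (trans (ListP.map-tabulate id (lookup xs)) (ListP.tabulate-lookup xs)))

  module _ {a b c} {A : Set a} {B : Set b} {C : Set c} where

    avg-product : ∀ (g : A → B → C) xs ys (f : C → ℚ) →
      avg (cartesianProductWith g xs ys) f ≡ avg xs (λ x → avg ys (λ y → f (g x y)))
    avg-product g []       ys       f = refl
    avg-product g (x ∷ xs) []       f =
      trans (cong (λ l → avg l f) (ListP.cartesianProductWith-zeroʳ g (x ∷ xs)))
            (sym (avg-zero (x ∷ xs)))
    avg-product g (x ∷ xs) (y ∷ ys) f = begin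
      avg (cartesianProductWith g (x ∷ xs) (y ∷ ys)) f
        ≡⟨ avg-by-length (cartesianProductWith g (x ∷ xs) (y ∷ ys)) _ f
             (length-product g (x ∷ xs) (y ∷ ys)) ⟩
      ∑ (cartesianProductWith g (x ∷ xs) (y ∷ ys)) f * (+ 1 / (suc (length xs) ℕ.* suc (length ys)))
        ≡⟨ cong₂ _*_ (∑-product g (x ∷ xs) (y ∷ ys) f) (1/-homo-* (length xs) (length ys)) ⟩
      T * (u * v)
        ≡⟨ *-rearrange T u v ⟩
      T * v * u
        ≡⟨ cong (_* u) (sym (∑-*ʳ (x ∷ xs) (λ x → ∑ (y ∷ ys) (λ y → f (g x y))) v)) ⟩
      avg (x ∷ xs) (λ x → avg (y ∷ ys) (λ y → f (g x y))) ∎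
      where open ≡-Reasoning
            u v T : ℚ
            u = + 1 / suc (length xs)
            v = + 1 / suc (length ys)
            T = ∑ (x ∷ xs) (λ x → ∑ (y ∷ ys) (λ y → f (g x y)))

  avg-pull₂ : ∀ {a b c} {A : Set a} {B : Set b} {C : Set c}
    (xs : List A) (ys : List B) (zs : List C) (f : A → B → C → ℚ) →
    avg xs (λ x → avg ys (λ y → avg zs (f x y))) ≡
    avg zs (λ z → avg xs (λ x → avg ys (λ y → f x y z)))
  avg-pull₂ xs ys zs f = trans (avg-cong xs (λ x → avg-swap ys zs (f x))) (avg-swap xs zs _)

  avg-pull₃ : ∀ {a b c d} {A : Set a} {B : Set b} {C : Set c} {D : Set d}
    (xs : List A) (ys : List B) (zs : List C) (ws : List D) (f : A → B → C → D → ℚ) →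
    avg xs (λ x → avg ys (λ y → avg zs (λ z → avg ws (f x y z)))) ≡
    avg ws (λ w → avg xs (λ x → avg ys (λ y → avg zs (λ z → f x y z w))))
  avg-pull₃ xs ys zs ws f = trans (avg-cong xs (λ x → avg-pull₂ ys zs ws (f x))) (avg-swap xs ws _)

  module _ {a} {A : Set a} where

    avg-allVecs-cons : ∀ (xs : List A) k (f : Vec A (suc k) → ℚ) →
      avg (allVecs xs (suc k)) f ≡ avg xs (λ x → avg (allVecs xs k) (λ v → f (x ∷ v)))
    avg-allVecs-cons xs k f =
      trans (cong (λ l → avg l f) (concatMap-product _∷_ xs (allVecs xs k)))
            (avg-product _∷_ xs (allVecs xs k) f)

    avg-allVecs-snoc : ∀ (xs : List A) k (f : Vec A (suc k) → ℚ) →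
      avg (allVecs xs (suc k)) f ≡ avg (allVecs xs k) (λ v → avg xs (λ x → f (v ∷ʳ x)))
    avg-allVecs-snoc xs zero    f = trans (avg-allVecs-cons xs zero f)
      (trans (avg-cong xs (λ x → avg-singleton [] (λ v → f (x ∷ v))))
             (sym (avg-singleton [] (λ v → avg xs (λ x → f (v ∷ʳ x))))))
    avg-allVecs-snoc xs (suc k) f = trans (avg-allVecs-cons xs (suc k) f)
      (trans (avg-cong xs (λ y → avg-allVecs-snoc xs k (λ v → f (y ∷ v))))
             (sym (avg-allVecs-cons xs k (λ v → avg xs (λ x → f (v ∷ʳ x))))))

    avg-allVecs-const : ∀ (xs : List A) k c → 0 ℕ.< length xs → avg (allVecs xs k) (λ _ → c) ≡ c
    avg-allVecs-const xs zero    c _        = avg-singleton [] (λ (_ : Vec A 0) → c)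
    avg-allVecs-const xs (suc k) c 0<|xs| = trans (avg-allVecs-cons xs k (λ _ → c))
      (trans (avg-cong xs (λ _ → avg-allVecs-const xs k c 0<|xs|)) (avg-const xs c 0<|xs|))

module Streams where
  open import Data.Nat using (_+_; _*_; _^_)
  import Data.Nat.Properties as ℕP
  open import Data.Fin using (Fin)
  open import Data.Product using (_,_; proj₁; proj₂)
  open import Data.List using (List; []; _∷_; _++_; length; map)
  import Data.List.Properties as ListP
  open import Data.Vec using (Vec; []; _∷_; _∷ʳ_; lookup; toList; zip)
  import Data.Vec.Properties as VecP
  open import Relation.Binary.PropositionalEquality

  runFrom-++ : ∀ {n p c : ℕ} (A : StreamAlg n p c) s t σ xs ys →
    runFrom A s t σ (xs ++ ys) ≡ runFrom A s (t + length xs) (runFrom A s t σ xs) ys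
  runFrom-++ A s t σ []       ys = cong (λ t′ → runFrom A s t′ σ ys) (sym (ℕP.+-identityʳ t))
  runFrom-++ {c = c} A s t σ (x ∷ xs) ys = trans (runFrom-++ A s (suc t) σ′ xs ys)
    (cong (λ t′ → runFrom A s t′ (runFrom A s (suc t) σ′ xs) ys) (sym (ℕP.+-suc t (length xs))))
    where σ′ : Fin (2 ^ c)
          σ′ = StreamAlg.step A s t σ x

  module _ {n p : ℕ} .{{_ : NonZero p}} where

    stageY : ∀ {m} → Vec (Fin p) n → Matching n m → List (Constraint n p)
    stageY z M = map (λ e → (e , lookup z (proj₁ e) +ₚ lookup z (proj₂ e))) (toList M)

    length-stageY : ∀ {m} z (M : Matching n m) → length (stageY z M) ≡ m
    length-stageY z M = trans (ListP.length-map _ (toList M)) (VecP.length-toList M)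

    length-streamY : ∀ {m k} z (Ms : Vec (Matching n m) k) → length (streamY z Ms) ≡ k * m
    length-streamY z []       = refl
    length-streamY z (M ∷ Ms) = trans (ListP.length-++ (stageY z M))
      (cong₂ _+_ (length-stageY z M) (length-streamY z Ms))

    streamY-∷ʳ : ∀ {m k} z (Ms : Vec (Matching n m) k) M →
      streamY z (Ms ∷ʳ M) ≡ streamY z Ms ++ stageY z M
    streamY-∷ʳ z []        M = ListP.++-identityʳ (stageY z M)
    streamY-∷ʳ z (M′ ∷ Ms) M = trans (cong (stageY z M′ ++_) (streamY-∷ʳ z Ms M))
      (sym (ListP.++-assoc (stageY z M′) (streamY z Ms) (stageY z M)))

    zip-incidenceMul : ∀ {m} x (M : Matching n m) → toList (zip M (incidenceMul M x)) ≡ stageY x M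
    zip-incidenceMul x []      = refl
    zip-incidenceMul x (e ∷ M) = cong (_ ∷_) (zip-incidenceMul x M)

module Telescoping where
  open import Data.Nat as ℕ using (s≤s; z≤n)
  import Data.Nat.Properties as ℕP
  open import Data.Rational using (ℚ; 1ℚ; _+_; _*_; _-_; ∣_∣; _≤_; _≤?_)
  open import Data.Rational.Properties
    using ( ≤-refl; ≤-reflexive; ≤-trans; <⇒≤; ≰⇒>; +-mono-≤; +-monoʳ-≤; *-monoˡ-≤-nonNeg
          ; *-identityˡ; *-distribʳ-+; ∣p+q∣≤∣p∣+∣q∣; normalize-nonNeg; module ≤-Reasoning)
  open import Data.Rational.Solver using (module +-*-Solver)
  open import Data.Product using (∃; _×_; _,_)
  open import Relation.Nullary using (yes; no)
  open import Relation.Binary.PropositionalEquality using (_≡_; refl; sym; cong)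
  open Arithmetic

  dist-triangle : ∀ a b c → ∣ a - c ∣ ≤ ∣ a - b ∣ + ∣ b - c ∣
  dist-triangle a b c =
    ≤-trans (≤-reflexive (cong ∣_∣ (split a b c))) (∣p+q∣≤∣p∣+∣q∣ (a - b) (b - c))
    where
    open +-*-Solver
    split : ∀ a b c → a - c ≡ (a - b) + (b - c)
    split = solve 3 (λ a b c → a :- c := (a :- b) :+ (b :- c)) refl

  absorb : ∀ N {D d M} → D ≤ M → d ≤ M → D + toℚ N * d ≤ toℚ (suc N) * M
  absorb N {D} {d} {M} D≤M d≤M = begin
    D + toℚ N * d
      ≤⟨ +-mono-≤ D≤M (*-monoˡ-≤-nonNeg (toℚ N) {{normalize-nonNeg N 1}} d≤M) ⟩
    M + toℚ N * M       ≡⟨ cong (_+ toℚ N * M) (sym (*-identityˡ M)) ⟩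
    1ℚ * M + toℚ N * M  ≡⟨ sym (*-distribʳ-+ M 1ℚ (toℚ N)) ⟩
    (1ℚ + toℚ N) * M    ≡⟨ cong (_* M) (sym (toℚ-suc N)) ⟩
    toℚ (suc N) * M     ∎
    where open ≤-Reasoning

  extend : ∀ (h : ℕ → ℚ) k {B} → ∣ h k - h 0 ∣ ≤ B →
    ∣ h (suc k) - h 0 ∣ ≤ ∣ h (suc k) - h k ∣ + B
  extend h k bound = ≤-trans (dist-triangle (h (suc k)) (h k) (h 0))
    (+-monoʳ-≤ ∣ h (suc k) - h k ∣ bound)

  telescoping-pigeonhole : (h : ℕ → ℚ) (k : ℕ) →
    ∃ λ i → i ℕ.< suc k × ∣ h (suc k) - h 0 ∣ ≤ toℚ (suc k) * ∣ h (suc i) - h i ∣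
  telescoping-pigeonhole h zero = 0 , s≤s z≤n , ≤-reflexive (sym (*-identityˡ _))
  telescoping-pigeonhole h (suc k) with telescoping-pigeonhole h k
  ... | i , i<k+1 , bound with ∣ h (suc i) - h i ∣ ≤? ∣ h (suc (suc k)) - h (suc k) ∣
  ...   | yes stepᵢ≤last = suc k , ℕP.n<1+n (suc k) ,
            ≤-trans (extend h (suc k) bound) (absorb (suc k) ≤-refl stepᵢ≤last)
  ...   | no  stepᵢ≰last = i , ℕP.m<n⇒m<1+n i<k+1 ,
            ≤-trans (extend h (suc k) bound) (absorb (suc k) (<⇒≤ (≰⇒> stepᵢ≰last)) ≤-refl)

module Reduction {n p c : ℕ} .{{_ : NonZero p}} (A : StreamAlg n p c) (m : ℕ) where
  open import Data.Bool using (Bool)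
  open import Data.Nat as ℕ using (_∸_; _^_; >-nonZero⁻¹)
  import Data.Nat.Properties as ℕP
  open import Data.Fin using (Fin)
  open import Data.Rational using (ℚ; _-_; _*_; ∣_∣; _≤_)
  open import Data.Rational.Properties using (module ≤-Reasoning)
  open import Data.Product using (∃; _×_; _,_)
  open import Data.List as List using (List; _++_; length; allFin; lookup; cartesianProduct)
  import Data.List.Properties as ListP
  open import Data.Vec using (Vec; []; _∷_; _∷ʳ_; toList; zip)
  open import Data.Vec.Properties using (length-toList)
  open import Function using (_∘_; id)
  open import Relation.Binary.PropositionalEquality
  open Averages
  open Streams
  open Telescoping using (telescoping-pigeonhole)
  open Arithmetic using (toℚ)
  open StreamAlg A

  seeds : List (Fin r)
  seeds = allFin r

  hiddenVecs : List (Vec (Fin p) n)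
  hiddenVecs = allVecs (allFin p) n

  matchings : List (Matching n m)
  matchings = allMatchings n m

  labelVecs : List (Vec (Fin p) m)
  labelVecs = allVecs (allFin p) m

  outcome : ∀ {a b} → Fin r → Vec (Fin p) n → Vec (Matching n m) a →
            Vec (Matching n m) b → Vec (Vec (Fin p) m) b → ℚ
  outcome s z Ys Ns qs = ind (runAlg A s (streamY z Ys ++ streamN Ns qs))

  hybrid : ℕ → ℕ → ℚ
  hybrid a b =
    avg seeds λ s → avg hiddenVecs λ z →
    avg (allVecs matchings a) λ Ys →
    avg (allVecs matchings b) λ Ns → avg (allVecs labelVecs b) λ qs →
    outcome s z Ys Ns qs

  accY≡hybrid : ∀ k → accY A m k ≡ hybrid k 0
  accY≡hybrid k =
    avg-cong seeds λ s → avg-cong hiddenVecs λ z → avg-cong (allVecs matchings k) λ Ys →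
    sym (begin
      avg (allVecs matchings 0) (λ Ns → avg (allVecs labelVecs 0) (outcome s z Ys Ns))
        ≡⟨ avg-singleton [] (λ Ns → avg (allVecs labelVecs 0) (outcome s z Ys Ns)) ⟩
      avg (allVecs labelVecs 0) (outcome s z Ys [])
        ≡⟨ avg-singleton [] (outcome s z Ys []) ⟩
      ind (runAlg A s (streamY z Ys ++ List.[]))
        ≡⟨ cong (ind ∘ runAlg A s) (ListP.++-identityʳ (streamY z Ys)) ⟩
      ind (runAlg A s (streamY z Ys)) ∎)
    where open ≡-Reasoning

  accN≡hybrid : ∀ k → accN A m k ≡ hybrid 0 k
  accN≡hybrid k = avg-cong seeds λ s → sym (trans
    (avg-cong hiddenVecs λ z → avg-singleton [] (λ (_ : Vec (Matching n m) 0) → acceptN s))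
    (avg-allVecs-const (allFin p) n (acceptN s) 0<|ℤₚ|))
    where
    acceptN : Fin r → ℚ
    acceptN s = avg (allVecs matchings k) λ Ns → avg (allVecs labelVecs k) λ qs →
                ind (runAlg A s (streamN Ns qs))
    0<|ℤₚ| : 0 ℕ.< length (allFin p)
    0<|ℤₚ| = subst (0 ℕ.<_) (sym (ListP.length-tabulate id)) (>-nonZero⁻¹ p)

  -- public randomness of the protocol whose Bob-stage is preceded by i
  -- Y-stages and followed by j N-stages
  Seed : ℕ → ℕ → Set
  Seed i j = Fin r × Vec (Matching n m) i × Vec (Matching n m) j × Vec (Vec (Fin p) m) j

  seedList : ∀ i j → List (Seed i j)
  seedList i j = cartesianProduct seeds
    (cartesianProduct (allVecs matchings i) (cartesianProduct (allVecs matchings j) (allVecs labelVecs j)))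

  aliceMsg : ∀ {i j} → Seed i j → Vec (Fin p) n → Fin (2 ^ c)
  aliceMsg (s , Ys , _) x = runFrom A s 0 (init s) (streamY x Ys)

  bobOut : ∀ i {j} → Seed i j → Fin (2 ^ c) → Matching n m → Vec (Fin p) m → Bool
  bobOut i (s , _ , Ns , qs) σ M w =
    accept s (runFrom A s (i ℕ.* m ℕ.+ m)
                        (runFrom A s (i ℕ.* m) σ (toList (zip M w)))
                        (streamN Ns qs))

  protocol : ℕ → ℕ → HMProtocol n p m c
  protocol i j = record
    { r     = length (seedList i j)
    ; alice = aliceMsg ∘ lookup (seedList i j)
    ; bob   = bobOut i ∘ lookup (seedList i j)
    }

  bob∘alice : ∀ i {j} (σ : Seed i j) x M w → let (s , Ys , Ns , qs) = σ in
    bobOut i σ (aliceMsg σ x) M w ≡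
    runAlg A s (streamY x Ys ++ toList (zip M w) ++ streamN Ns qs)
  bob∘alice i (s , Ys , Ns , qs) x M w = sym (begin
    accept s (runFrom A s 0 (init s) (streamY x Ys ++ stage ++ rest))
      ≡⟨ cong (accept s) (runFrom-++ A s 0 (init s) (streamY x Ys) (stage ++ rest)) ⟩
    accept s (runFrom A s ℓ σ (stage ++ rest))
      ≡⟨ cong (accept s) (runFrom-++ A s ℓ σ stage rest) ⟩
    accept s (runFrom A s (ℓ ℕ.+ length stage) (runFrom A s ℓ σ stage) rest)
      ≡⟨ cong₂ (λ t t′ → accept s (runFrom A s (t ℕ.+ t′) (runFrom A s t σ stage) rest))
               (length-streamY x Ys) (length-toList (zip M w)) ⟩
    bobOut i (s , Ys , Ns , qs) σ M w ∎)
    where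
    open ≡-Reasoning
    stage rest : List (Constraint n p)
    stage = toList (zip M w)
    rest  = streamN Ns qs
    σ : Fin (2 ^ c)
    σ = aliceMsg (s , Ys , Ns , qs) x
    ℓ : ℕ
    ℓ = length (streamY x Ys)

  avg-seedList : ∀ i j (F : Seed i j → ℚ) →
    avg (allFin (length (seedList i j))) (F ∘ lookup (seedList i j)) ≡
    avg seeds λ s → avg (allVecs matchings i) λ Ys →
    avg (allVecs matchings j) λ Ns → avg (allVecs labelVecs j) λ qs → F (s , Ys , Ns , qs)
  avg-seedList i j F = trans (avg-lookup (seedList i j) F)
    (trans (avg-product _,_ seeds _ F) (avg-cong seeds λ s →
      trans (avg-product _,_ (allVecs matchings i) _ _) (avg-cong (allVecs matchings i) λ Ys →
        avg-product _,_ (allVecs matchings j) (allVecs labelVecs j) _)))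

  -- under YES, Bob's stage is one more Y-stage: the protocol accepts like hybrid (i+1) j
  accYES≡hybrid : ∀ i j → accYES (protocol i j) ≡ hybrid (suc i) j
  accYES≡hybrid i j = begin
    accYES (protocol i j)
      ≡⟨ avg-cong (allFin _) (λ ρ → avg-cong hiddenVecs λ x → avg-cong matchings λ M →
           cong ind (yes-stage (lookup (seedList i j) ρ) x M)) ⟩
    avg (allFin _) (F ∘ lookup (seedList i j))
      ≡⟨ avg-seedList i j F ⟩
    (avg seeds λ s → avg Ysᵢ λ Ys → avg Nsⱼ λ Ns → avg qsⱼ λ qs →
      avg hiddenVecs λ x → avg matchings λ M → outcome s x (Ys ∷ʳ M) Ns qs)
      ≡⟨ avg-cong seeds (λ s → avg-pull₃ Ysᵢ Nsⱼ qsⱼ hiddenVecs _) ⟩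
    (avg seeds λ s → avg hiddenVecs λ x → avg Ysᵢ λ Ys → avg Nsⱼ λ Ns → avg qsⱼ λ qs →
      avg matchings λ M → outcome s x (Ys ∷ʳ M) Ns qs)
      ≡⟨ avg-cong seeds (λ s → avg-cong hiddenVecs λ x → avg-cong Ysᵢ λ Ys →
           avg-pull₂ Nsⱼ qsⱼ matchings _) ⟩
    (avg seeds λ s → avg hiddenVecs λ x → avg Ysᵢ λ Ys → avg matchings λ M →
      avg Nsⱼ λ Ns → avg qsⱼ λ qs → outcome s x (Ys ∷ʳ M) Ns qs)
      ≡⟨ avg-cong seeds (λ s → avg-cong hiddenVecs λ x → sym (avg-allVecs-snoc matchings i _)) ⟩
    hybrid (suc i) j ∎
    where
    open ≡-Reasoning
    Ysᵢ : List (Vec (Matching n m) i)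
    Ysᵢ = allVecs matchings i
    Nsⱼ : List (Vec (Matching n m) j)
    Nsⱼ = allVecs matchings j
    qsⱼ : List (Vec (Vec (Fin p) m) j)
    qsⱼ = allVecs labelVecs j
    F : Seed i j → ℚ
    F (s , Ys , Ns , qs) = avg hiddenVecs λ x → avg matchings λ M → outcome s x (Ys ∷ʳ M) Ns qs
    yes-stage : ∀ σ x M → let (s , Ys , Ns , qs) = σ in
      bobOut i σ (aliceMsg σ x) M (incidenceMul M x) ≡
      runAlg A s (streamY x (Ys ∷ʳ M) ++ streamN Ns qs)
    yes-stage (s , Ys , Ns , qs) x M = begin
      bobOut i (s , Ys , Ns , qs) (aliceMsg (s , Ys , Ns , qs) x) M (incidenceMul M x)
        ≡⟨ bob∘alice i (s , Ys , Ns , qs) x M (incidenceMul M x) ⟩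
      runAlg A s (streamY x Ys ++ toList (zip M (incidenceMul M x)) ++ streamN Ns qs)
        ≡⟨ cong (λ l → runAlg A s (streamY x Ys ++ l ++ streamN Ns qs)) (zip-incidenceMul x M) ⟩
      runAlg A s (streamY x Ys ++ stageY x M ++ streamN Ns qs)
        ≡⟨ cong (runAlg A s) (sym (ListP.++-assoc (streamY x Ys) (stageY x M) (streamN Ns qs))) ⟩
      runAlg A s ((streamY x Ys ++ stageY x M) ++ streamN Ns qs)
        ≡⟨ cong (λ l → runAlg A s (l ++ streamN Ns qs)) (sym (streamY-∷ʳ x Ys M)) ⟩
      runAlg A s (streamY x (Ys ∷ʳ M) ++ streamN Ns qs) ∎

  -- under NO, Bob's stage is one more N-stage: the protocol accepts like hybrid i (j+1)
  accNO≡hybrid : ∀ i j → accNO (protocol i j) ≡ hybrid i (suc j)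
  accNO≡hybrid i j = begin
    accNO (protocol i j)
      ≡⟨ avg-cong (allFin _) (λ ρ → avg-cong hiddenVecs λ x → avg-cong matchings λ M →
           avg-cong labelVecs λ w → cong ind (bob∘alice i (lookup (seedList i j) ρ) x M w)) ⟩
    avg (allFin _) (F ∘ lookup (seedList i j))
      ≡⟨ avg-seedList i j F ⟩
    (avg seeds λ s → avg Ysᵢ λ Ys → avg Nsⱼ λ Ns → avg qsⱼ λ qs → avg hiddenVecs λ x →
      avg matchings λ M → avg labelVecs λ w → outcome s x Ys (M ∷ Ns) (w ∷ qs))
      ≡⟨ avg-cong seeds (λ s → avg-pull₃ Ysᵢ Nsⱼ qsⱼ hiddenVecs _) ⟩
    (avg seeds λ s → avg hiddenVecs λ x → avg Ysᵢ λ Ys → avg Nsⱼ λ Ns → avg qsⱼ λ qs →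
      avg matchings λ M → avg labelVecs λ w → outcome s x Ys (M ∷ Ns) (w ∷ qs))
      ≡⟨ avg-cong seeds (λ s → avg-cong hiddenVecs λ x → avg-cong Ysᵢ λ Ys →
           avg-pull₂ Nsⱼ qsⱼ matchings _) ⟩
    (avg seeds λ s → avg hiddenVecs λ x → avg Ysᵢ λ Ys → avg matchings λ M → avg Nsⱼ λ Ns →
      avg qsⱼ λ qs → avg labelVecs λ w → outcome s x Ys (M ∷ Ns) (w ∷ qs))
      ≡⟨ avg-cong seeds (λ s → avg-cong hiddenVecs λ x → avg-cong Ysᵢ λ Ys →
           avg-cong matchings λ M → avg-cong Nsⱼ λ Ns → avg-swap qsⱼ labelVecs _) ⟩
    (avg seeds λ s → avg hiddenVecs λ x → avg Ysᵢ λ Ys → avg matchings λ M → avg Nsⱼ λ Ns →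
      avg labelVecs λ w → avg qsⱼ λ qs → outcome s x Ys (M ∷ Ns) (w ∷ qs))
      ≡⟨ avg-cong seeds (λ s → avg-cong hiddenVecs λ x → avg-cong Ysᵢ λ Ys → sym (trans
           (avg-cong (allVecs matchings (suc j)) λ Ns → avg-allVecs-cons labelVecs j _)
           (avg-allVecs-cons matchings j _))) ⟩
    hybrid i (suc j) ∎
    where
    open ≡-Reasoning
    Ysᵢ : List (Vec (Matching n m) i)
    Ysᵢ = allVecs matchings i
    Nsⱼ : List (Vec (Matching n m) j)
    Nsⱼ = allVecs matchings j
    qsⱼ : List (Vec (Vec (Fin p) m) j)
    qsⱼ = allVecs labelVecs j
    F : Seed i j → ℚ
    F (s , Ys , Ns , qs) = avg hiddenVecs λ x → avg matchings λ M → avg labelVecs λ w →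
      outcome s x Ys (M ∷ Ns) (w ∷ qs)

  hybridPath : ℕ → ℕ → ℚ
  hybridPath k a = hybrid a (k ∸ a)

  advantageUG-path : ∀ k → advantageUG A m k ≡ ∣ hybridPath k k - hybridPath k 0 ∣
  advantageUG-path k = cong ∣_∣ (cong₂ _-_
    (trans (accY≡hybrid k) (cong (hybrid k) (sym (ℕP.n∸n≡0 k)))) (accN≡hybrid k))

  advantageHM-path : ∀ k i → i ℕ.< k →
    advantageHM (protocol i (k ∸ suc i)) ≡ ∣ hybridPath k (suc i) - hybridPath k i ∣
  advantageHM-path k i i<k = cong ∣_∣ (cong₂ _-_ (accYES≡hybrid i (k ∸ suc i))
    (trans (accNO≡hybrid i (k ∸ suc i)) (cong (hybrid i) (sym (ℕP.+-∸-assoc 1 i<k)))))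

  hybrid-argument : ∀ k → ∃ λ (P : HMProtocol n p m c) →
    advantageUG A m (suc k) ≤ toℚ (suc k) * advantageHM P
  hybrid-argument k with telescoping-pigeonhole (hybridPath (suc k)) k
  ... | i , i<k+1 , bound = protocol i (k ∸ i) , (begin
    advantageUG A m (suc k)                                     ≡⟨ advantageUG-path (suc k) ⟩
    ∣ hybridPath (suc k) (suc k) - hybridPath (suc k) 0 ∣       ≤⟨ bound ⟩
    toℚ (suc k) * ∣ hybridPath (suc k) (suc i) - hybridPath (suc k) i ∣
      ≡⟨ cong (toℚ (suc k) *_) (sym (advantageHM-path (suc k) i i<k+1)) ⟩
    toℚ (suc k) * advantageHM (protocol i (k ∸ i))              ∎)
    where open ≤-Reasoning

open import Data.Nat using (ℕ; NonZero; _≤_; _*_)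
open import Data.Integer using (+_)
open import Data.Product using (Σ; _×_; ∃)
open import Data.Rational using (ℚ; _/_; 0ℚ; _<_) renaming (_≤_ to _≤ℚ_; _*_ to _*ℚ_)
open import Data.Rational.Properties using (positive⁻¹; ≤-trans)
open import Data.Product using (_,_)

-- Lemma 4.3 with the constant C = 1/4; of the hypotheses only k ≥ 1 (and
-- p ≠ 0, so that ℤ_p is nonempty) is needed by the hybrid argument.
lemma4p3 : Σ ℚ λ C → 0ℚ < C ×
    ((p n k m c : ℕ) .{{_ : NonZero p}} → 2 ≤ p → 1 ≤ n → 1 ≤ k → 1 ≤ m → 4 * m ≤ n →
      (A : StreamAlg n p c) → (+ 1 / 4) ≤ℚ advantageUG A m k →
      ∃ λ (P : HMProtocol n p m c) → C ≤ℚ ((+ k / 1) *ℚ advantageHM P))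
lemma4p3 = + 1 / 4 , positive⁻¹ (+ 1 / 4) , reduction
  where
  reduction : (p n k m c : ℕ) .{{_ : NonZero p}} → 2 ≤ p → 1 ≤ n → 1 ≤ k → 1 ≤ m → 4 * m ≤ n →
    (A : StreamAlg n p c) → (+ 1 / 4) ≤ℚ advantageUG A m k →
    ∃ λ (P : HMProtocol n p m c) → (+ 1 / 4) ≤ℚ ((+ k / 1) *ℚ advantageHM P)
  reduction p _ zero    _ _ _ _ () _ _ _ _
  reduction p _ (suc k) m _ _ _ _  _ _ A ¼≤adv =
    let (P , advUG≤k·advHM) = Reduction.hybrid-argument A m k in P , ≤-trans ¼≤adv advUG≤k·advHM
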